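{- Let $\mathbf{A}$ be a $\lambda$-model satisfying $\Theta xx=\Omega$ and $\Theta x\Omega = x$, and let $o\in A$ be the interpretation of $\Omega$. Then for every combinatory algebra $\mathbf{B}$, every injective homomorphism of combinatory algebras $f:\mathbf{A}\to\mathbf{B}$, and every partial order $\le$ on $B$ for which application is monotone in both arguments, the element $f(o)$ is incomparable with every element of $B$ other than itself.
   Context: $\Omega \equiv (\lambda x.xx)(\lambda x.xx)$, $B \equiv \lambda x.x(\lambda y.yx)$, $C \equiv \lambda z.zB$, $\Theta \equiv BC$. A combinatory algebra is a structure $(A,\cdot,K,S)$ with a binary application satisfying $Kxy=x$, $Sxyz=xz(yz)$; homomorphisms preserve application, $K$ and $S$. With $I\equiv SKK$, $\varepsilon\equiv\varepsilon_1\equiv S(KI)$, $\varepsilon_{n+1}\equiv S(K\varepsilon)(S(K\varepsilon_n))$, a $\lambda$-model is a combinatory algebra satisfying $\forall xy((\forall z.\ xz=yz)\Rightarrow\varepsilon x=\varepsilon y)$, $\varepsilon_2K=K$, $\varepsilon_3S=S$; $\lambda$-terms are interpreted in the standard way, and an equation holds if both sides have equal interpretation in every environment. (In the paper's terminology the conclusion says $\mathbf{A}$ is absolutely $\Omega$-unorderable in the variety of combinatory algebras.) -}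

module Defs where

open import Level using (Level; _⊔_; suc)
open import Data.Nat using (ℕ; _≡ᵇ_)
open import Data.Bool using (if_then_else_)
open import Data.Product using (_×_)
open import Relation.Binary.PropositionalEquality using (_≡_)
open import Relation.Binary.Core using (Rel)
open import Relation.Binary.Structures using (IsPartialOrder)
open import Function.Definitions using (Injective)

infixl 9 _·ᶜ_

record CombAlg (a : Level) : Set (suc a) where
  infixl 9 _·_
  field
    Carrier : Set a
    _·_     : Carrier → Carrier → Carrier
    K S     : Carrier
    K-law   : ∀ x y → K · x · y ≡ x
    S-law   : ∀ x y z → S · x · y · z ≡ x · z · (y · z)

  I : Carrier
  I = S · K · K

  ε : Carrier
  ε = S · (K · I)

  -- ε₁ = ε, ε_{n+1} = S(Kε)(S(Kε_n)); εₙ n denotes ε_{n+1}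
  εₙ : ℕ → Carrier
  εₙ ℕ.zero    = ε
  εₙ (ℕ.suc n) = S · (K · ε) · (S · (K · εₙ n))

  ε₂ ε₃ : Carrier
  ε₂ = εₙ 1
  ε₃ = εₙ 2

-- λ-models: combinatory algebras satisfying the Meyer–Scott axioms.
record IsLambdaModel {a : Level} (A : CombAlg a) : Set a where
  open CombAlg A
  field
    weak-ext : ∀ x y → (∀ z → x · z ≡ y · z) → ε · x ≡ ε · y
    ε₂K      : ε₂ · K ≡ K
    ε₃S      : ε₃ · S ≡ S

record IsHom {a b : Level} (A : CombAlg a) (B : CombAlg b)
             (f : CombAlg.Carrier A → CombAlg.Carrier B) : Set (a ⊔ b) where
  private
    module A = CombAlg A
    module B = CombAlg B
  field
    pres-· : ∀ x y → f (x A.· y) ≡ f x B.· f y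
    pres-K : f A.K ≡ B.K
    pres-S : f A.S ≡ B.S

record AppMonotone {b ℓ : Level} (B : CombAlg b)
                   (_≤_ : Rel (CombAlg.Carrier B) ℓ) : Set (b ⊔ ℓ) where
  open CombAlg B
  field
    mono-left  : ∀ {x x′ y} → x ≤ x′ → (x · y) ≤ (x′ · y)
    mono-right : ∀ {x y y′} → y ≤ y′ → (x · y) ≤ (x · y′)

data Λ : Set where
  var : ℕ → Λ
  app : Λ → Λ → Λ
  lam : ℕ → Λ → Λ

data CL : Set where
  var : ℕ → CL
  k s : CL
  _·ᶜ_ : CL → CL → CL

abs : ℕ → CL → CL
abs x (var y)  = if x ≡ᵇ y then (s ·ᶜ k ·ᶜ k) else (k ·ᶜ var y)
abs x k        = k ·ᶜ k
abs x s        = k ·ᶜ s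
abs x (P ·ᶜ Q) = s ·ᶜ abs x P ·ᶜ abs x Q

toCL : Λ → CL
toCL (var x)   = var x
toCL (app M N) = toCL M ·ᶜ toCL N
toCL (lam x M) = abs x (toCL M)

module _ {a : Level} (A : CombAlg a) where
  open CombAlg A

  ⟦_⟧ᶜ : CL → (ℕ → Carrier) → Carrier
  ⟦ var x ⟧ᶜ ρ  = ρ x
  ⟦ k ⟧ᶜ ρ      = K
  ⟦ s ⟧ᶜ ρ      = S
  ⟦ P ·ᶜ Q ⟧ᶜ ρ = ⟦ P ⟧ᶜ ρ · ⟦ Q ⟧ᶜ ρ

  ⟦_⟧ : Λ → (ℕ → Carrier) → Carrier
  ⟦ M ⟧ ρ = ⟦ toCL M ⟧ᶜ ρ

  Holds : Λ → Λ → Set a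
  Holds M N = ∀ ρ → ⟦ M ⟧ ρ ≡ ⟦ N ⟧ ρ

x′ y′ z′ : Λ
x′ = var 0
y′ = var 1
z′ = var 2

Ωᵗ : Λ
Ωᵗ = app (lam 0 (app x′ x′)) (lam 0 (app x′ x′))

Bᵗ : Λ
Bᵗ = lam 0 (app x′ (lam 1 (app y′ x′)))

Cᵗ : Λ
Cᵗ = lam 2 (app z′ Bᵗ)

Θᵗ : Λ
Θᵗ = app Bᵗ Cᵗ

-- interpretation of the closed term Ω (environment irrelevant)
oᴬ : ∀ {a} (A : CombAlg a) → CombAlg.Carrier A
oᴬ A = ⟦ A ⟧ Ωᵗ (λ _ → CombAlg.K A)

module Submission where

-- Write θ and o for the interpretations of Θ and Ω in A.  The two
-- equations say that θxx = o and θxo = x for every x ∈ A.  These are pointwise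
-- equalities between the combinators S·θ·I, K·o and S·θ·(K·o), I respectively,
-- so in a λ-model the weak extensionality axiom makes their ε-images equal.
-- Equalities between ε-images are preserved by any homomorphism f : A → B, and
-- ε·X·y = X·y holds in every combinatory algebra; hence T = f θ and O = f o
-- satisfy T·y·y = O and T·y·O = y for ALL y ∈ B, not only for y in the image of f.
-- Finally, in any combinatory algebra with a partial order for which application
-- is monotone, an element O admitting such a T is incomparable with every other
-- element: c ≤ O gives T·c·c ≤ T·c·O, i.e. O ≤ c, and symmetrically, so
-- antisymmetry forces c = O.

open import Defs
open import Level using (Level)
open import Relation.Binary.PropositionalEquality
  using (_≡_; sym; trans; cong; cong₂; subst₂; module ≡-Reasoning)
open import Relation.Binary.Core using (Rel)
open import Relation.Binary.Structures using (IsPartialOrder)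
open import Function.Definitions using (Injective)
open import Relation.Nullary using (¬_)
open import Data.Product using (_×_; _,_)

open ≡-Reasoning

module CombinatorLaws {a : Level} (C : CombAlg a) where
  open CombAlg C

  I-law : ∀ x → I · x ≡ x
  I-law x = trans (S-law K K x) (K-law x (K · x))

  ε-law : ∀ X y → ε · X · y ≡ X · y
  ε-law X y = begin
    S · (K · I) · X · y   ≡⟨ S-law (K · I) X y ⟩
    K · I · y · (X · y)   ≡⟨ cong (_· (X · y)) (K-law I y) ⟩
    I · (X · y)           ≡⟨ I-law (X · y) ⟩
    X · y                 ∎

  diag-law : ∀ t x → S · t · I · x ≡ t · x · x
  diag-law t x = trans (S-law t I x) (cong (t · x ·_) (I-law x))

  fix₂-law : ∀ t u x → S · t · (K · u) · x ≡ t · x · u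
  fix₂-law t u x = trans (S-law t (K · u) x) (cong (t · x ·_) (K-law u x))

module HomomorphismLaws {a b : Level} {A : CombAlg a} {B : CombAlg b}
                        {f : CombAlg.Carrier A → CombAlg.Carrier B}
                        (hom : IsHom A B f) where
  private
    module A = CombAlg A
    module B = CombAlg B
  open IsHom hom

  pres-K· : ∀ x → f (A.K A.· x) ≡ B.K B.· f x
  pres-K· x = trans (pres-· A.K x) (cong (B._· f x) pres-K)

  pres-S·· : ∀ x y → f (A.S A.· x A.· y) ≡ B.S B.· f x B.· f y
  pres-S·· x y = begin
    f (A.S A.· x A.· y)       ≡⟨ pres-· (A.S A.· x) y ⟩
    f (A.S A.· x) B.· f y     ≡⟨ cong (B._· f y) (pres-· A.S x) ⟩
    f A.S B.· f x B.· f y     ≡⟨ cong (λ s → s B.· f x B.· f y) pres-S ⟩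
    B.S B.· f x B.· f y       ∎

  pres-I : f A.I ≡ B.I
  pres-I = trans (pres-S·· A.K A.K) (cong₂ (λ p q → B.S B.· p B.· q) pres-K pres-K)

  pres-ε· : ∀ X → f (A.ε A.· X) ≡ B.ε B.· f X
  pres-ε· X = begin
    f (A.S A.· (A.K A.· A.I) A.· X)   ≡⟨ pres-S·· (A.K A.· A.I) X ⟩
    B.S B.· f (A.K A.· A.I) B.· f X   ≡⟨ cong (λ k → B.S B.· k B.· f X) (pres-K· A.I) ⟩
    B.S B.· (B.K B.· f A.I) B.· f X   ≡⟨ cong (λ i → B.S B.· (B.K B.· i) B.· f X) pres-I ⟩
    B.ε B.· f X                       ∎

-- This is what
-- lets equations of A be used at arguments outside the image of f.
transfer-ext : ∀ {a b} {A : CombAlg a} {B : CombAlg b}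
  {f : CombAlg.Carrier A → CombAlg.Carrier B} →
  IsLambdaModel A → IsHom A B f →
  ∀ X Y → (∀ z → CombAlg._·_ A X z ≡ CombAlg._·_ A Y z) →
  ∀ w → CombAlg._·_ B (f X) w ≡ CombAlg._·_ B (f Y) w
transfer-ext {A = A} {B} {f} lm hom X Y X≗Y w = begin
  f X · w              ≡⟨ sym (ε-law (f X) w) ⟩
  ε · f X · w          ≡⟨ cong (_· w) (sym (pres-ε· X)) ⟩
  f (A.ε A.· X) · w    ≡⟨ cong (λ e → f e · w) (IsLambdaModel.weak-ext lm X Y X≗Y) ⟩
  f (A.ε A.· Y) · w    ≡⟨ cong (_· w) (pres-ε· Y) ⟩
  ε · f Y · w          ≡⟨ ε-law (f Y) w ⟩
  f Y · w              ∎
  where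
  module A = CombAlg A
  open CombAlg B
  open CombinatorLaws B
  open HomomorphismLaws hom

-- The two equations of the corollary, read as identities between two elements t
-- and o of a combinatory algebra.
record ThetaOmega {a : Level} (C : CombAlg a) (t o : CombAlg.Carrier C) : Set a where
  open CombAlg C
  field
    diagonal : ∀ x → t · x · x ≡ o
    cancel   : ∀ x → t · x · o ≡ x

transfer-ThetaOmega : ∀ {a b} {A : CombAlg a} {B : CombAlg b}
  {f : CombAlg.Carrier A → CombAlg.Carrier B} →
  IsLambdaModel A → IsHom A B f →
  ∀ {t o} → ThetaOmega A t o → ThetaOmega B (f t) (f o)
transfer-ThetaOmega {A = A} {B} {f} lm hom {t} {o} th = record
  { diagonal = λ y → begin
      f t ·ᴮ y ·ᴮ y                           ≡⟨ sym (B.diag-law (f t) y) ⟩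
      Bc.S ·ᴮ f t ·ᴮ Bc.I ·ᴮ y                 ≡⟨ cong (_·ᴮ y) (sym diag-image) ⟩
      f (Ac.S ·ᴬ t ·ᴬ Ac.I) ·ᴮ y               ≡⟨ transfer-ext lm hom _ _ diagonalᴬ y ⟩
      f (Ac.K ·ᴬ o) ·ᴮ y                       ≡⟨ cong (_·ᴮ y) (pres-K· o) ⟩
      Bc.K ·ᴮ f o ·ᴮ y                         ≡⟨ Bc.K-law (f o) y ⟩
      f o                                      ∎
  ; cancel = λ y → begin
      f t ·ᴮ y ·ᴮ f o                          ≡⟨ sym (B.fix₂-law (f t) (f o) y) ⟩
      Bc.S ·ᴮ f t ·ᴮ (Bc.K ·ᴮ f o) ·ᴮ y         ≡⟨ cong (_·ᴮ y) (sym fix₂-image) ⟩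
      f (Ac.S ·ᴬ t ·ᴬ (Ac.K ·ᴬ o)) ·ᴮ y         ≡⟨ transfer-ext lm hom _ _ cancelᴬ y ⟩
      f Ac.I ·ᴮ y                              ≡⟨ cong (_·ᴮ y) pres-I ⟩
      Bc.I ·ᴮ y                                ≡⟨ B.I-law y ⟩
      y                                        ∎
  }
  where
  module Ac = CombAlg A
  module Bc = CombAlg B
  module A = CombinatorLaws A
  module B = CombinatorLaws B
  open HomomorphismLaws hom
  open ThetaOmega th
  infixl 9 _·ᴬ_ _·ᴮ_
  _·ᴬ_ : Ac.Carrier → Ac.Carrier → Ac.Carrier
  _·ᴬ_ = Ac._·_
  _·ᴮ_ : Bc.Carrier → Bc.Carrier → Bc.Carrier
  _·ᴮ_ = Bc._·_

  diagonalᴬ : ∀ z → Ac.S ·ᴬ t ·ᴬ Ac.I ·ᴬ z ≡ Ac.K ·ᴬ o ·ᴬ z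
  diagonalᴬ z = trans (A.diag-law t z) (trans (diagonal z) (sym (Ac.K-law o z)))

  cancelᴬ : ∀ z → Ac.S ·ᴬ t ·ᴬ (Ac.K ·ᴬ o) ·ᴬ z ≡ Ac.I ·ᴬ z
  cancelᴬ z = trans (A.fix₂-law t o z) (trans (cancel z) (sym (A.I-law z)))

  diag-image : f (Ac.S ·ᴬ t ·ᴬ Ac.I) ≡ Bc.S ·ᴮ f t ·ᴮ Bc.I
  diag-image = trans (pres-S·· t Ac.I) (cong (Bc.S ·ᴮ f t ·ᴮ_) pres-I)

  fix₂-image : f (Ac.S ·ᴬ t ·ᴬ (Ac.K ·ᴬ o)) ≡ Bc.S ·ᴮ f t ·ᴮ (Bc.K ·ᴮ f o)
  fix₂-image = trans (pres-S·· t (Ac.K ·ᴬ o)) (cong (Bc.S ·ᴮ f t ·ᴮ_) (pres-K· o))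

incomparable : ∀ {b ℓ} (B : CombAlg b) (_≤_ : Rel (CombAlg.Carrier B) ℓ) →
  IsPartialOrder _≡_ _≤_ → AppMonotone B _≤_ →
  ∀ {t o} → ThetaOmega B t o →
  ∀ c → ¬ (c ≡ o) → ¬ (c ≤ o) × ¬ (o ≤ c)
incomparable B _≤_ po mono {t} {o} th c c≢o =
  (λ c≤o → c≢o (antisym c≤o (flip-below c≤o))) ,
  (λ o≤c → c≢o (antisym (flip-above o≤c) o≤c))
  where
  open CombAlg B
  open IsPartialOrder po using (antisym)
  open AppMonotone mono using (mono-right)
  open ThetaOmega th

  -- t·c·c ≤ t·c·o, i.e. o ≤ c
  flip-below : c ≤ o → o ≤ c
  flip-below c≤o = subst₂ _≤_ (diagonal c) (cancel c) (mono-right c≤o)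

  -- t·c·o ≤ t·c·c, i.e. c ≤ o
  flip-above : o ≤ c → c ≤ o
  flip-above o≤c = subst₂ _≤_ (cancel c) (diagonal c) (mono-right o≤c)

corollary5p12 : ∀ {a b ℓ : Level} (A : CombAlg a) → IsLambdaModel A
    → Holds A (app (app Θᵗ x′) x′) Ωᵗ
    → Holds A (app (app Θᵗ x′) Ωᵗ) x′
    → (B : CombAlg b) (f : CombAlg.Carrier A → CombAlg.Carrier B)
    → IsHom A B f → Injective _≡_ _≡_ f
    → (_≤_ : Rel (CombAlg.Carrier B) ℓ) → IsPartialOrder _≡_ _≤_ → AppMonotone B _≤_
    → ∀ (c : CombAlg.Carrier B) → ¬ (c ≡ f (oᴬ A)) → ¬ (c ≤ f (oᴬ A)) × ¬ (f (oᴬ A) ≤ c)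
corollary5p12 A lm ΘxxΩ ΘxΩx B f hom _ _≤_ po mono =
  incomparable B _≤_ po mono (transfer-ThetaOmega lm hom equationsᴬ)
  where
  -- Θ and Ω are closed, so evaluating the equations in the constant environment
  -- at x yields θ·x·x = o and θ·x·o = x.
  equationsᴬ : ThetaOmega A (⟦ A ⟧ Θᵗ (λ _ → CombAlg.K A)) (oᴬ A)
  equationsᴬ = record { diagonal = λ x → ΘxxΩ (λ _ → x) ; cancel = λ x → ΘxΩx (λ _ → x) }
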